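{- Let $k\geq 3$, let $G$ be a graph of circumference less than $k$, and let $P=(x_1,\ldots,x_m)$ be a path of maximum length in $G$. Then for every $m'$ with $1\le m'\leq m$, every path in $G$ between $x_1$ and $x_{m'}$ has at most $m'-1+2(k-2)^2$ edges.
   Context: The circumference of a graph is the length of its longest cycle (a graph with no cycles counts as having circumference less than $k$). -}

module Defs where

open import Data.Nat using (ℕ; _≤_; _<_)
open import Data.Fin using (Fin)
open import Data.List using (List; []; _∷_; length; head; last)
open import Data.List.Relation.Unary.Linked using (Linked)
open import Data.List.Relation.Unary.Unique.Propositional using (Unique)
open import Data.Maybe using (Maybe; just)
open import Data.Product using (_×_)
open import Relation.Binary.PropositionalEquality using (_≡_)
open import Relation.Nullary using (¬_)

record Graph (n : ℕ) : Set₁ where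
  field
    Adj     : Fin n → Fin n → Set
    sym     : ∀ {u v} → Adj u v → Adj v u
    irrefl  : ∀ {u} → ¬ Adj u u
open Graph public

-- A path is a nonempty sequence of distinct vertices, consecutive ones adjacent.
-- Its number of edges is (length of the list) - 1.
record IsPath {n : ℕ} (G : Graph n) (xs : List (Fin n)) : Set where
  field
    nonempty : 1 ≤ length xs
    distinct : Unique xs
    linked   : Linked (Adj G) xs

IsPathBetween : {n : ℕ} → Graph n → Fin n → Fin n → List (Fin n) → Set
IsPathBetween G u v xs = IsPath G xs × head xs ≡ just u × last xs ≡ just v

record IsCycle {n : ℕ} (G : Graph n) (xs : List (Fin n)) : Set where
  field
    atLeast3 : 3 ≤ length xs
    distinct : Unique xs
    linked   : Linked (Adj G) xs
    closes   : ∀ {u v} → head xs ≡ just u → last xs ≡ just v → Adj G v u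

CircumferenceLessThan : {n : ℕ} → Graph n → ℕ → Set
CircumferenceLessThan G k = ∀ xs → IsCycle G xs → length xs < k

IsLongestPath : {n : ℕ} → Graph n → List (Fin n) → Set
IsLongestPath G P = IsPath G P × (∀ Q → IsPath G Q → length Q ≤ length P)

-- Write k = c + 2, so that every cycle has at most c + 1 vertices, let v = x_{m'} and let Q be a
-- path from x₁ to v. Let y be the first vertex of Q on the tail P[v, x_m]. Rerouting P along Q up
-- to y and then along P cannot give a longer path, so Q[x₁, y) has at most as many vertices as
-- P[x₁, y). If y ≠ v, then Q[x₁, y) meets P[x₁, v) (both start at x₁); from the last such
-- meeting vertex z, Q[z, y] and P[z, y] form a cycle, so P[v, y) has fewer than c vertices.
-- The rest Q[y, v] runs between two vertices of that cycle: each of its excursions off the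
-- cycle closes a cycle with an arc of it, hence has fewer than c inner vertices, and it visits at
-- most c vertices of the cycle, so it has at most c² edges. Altogether Q has at most
-- (m' - 1) + c + c² ≤ (m' - 1) + 2c² edges.
module Submission where

open import Defs
open import Data.Nat using (ℕ; suc; _≤_; _+_; _*_; _∸_; _^_)
open import Data.Fin using (Fin; toℕ)
open import Data.List using (List; length; lookup; head)
open import Data.Maybe using (just)
open import Relation.Binary.PropositionalEquality using (_≡_)

open import Function using (_∘_; flip)
open import Data.Nat using (z≤n; s≤s; _<_; NonZero)
open import Data.Nat.Properties
import Data.Fin as Fin
open import Data.List using ([]; _∷_; _++_; [_]; last; reverse; reverseAcc; filter)
open import Data.List.Properties
  using (++-assoc; ∷ʳ-++; ++-identityʳ; length-++; length-++-sucʳ; length-++-≤ʳ; length-reverse;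
         reverse-++; unfold-reverse; filter-accept)
open import Data.List.Membership.Propositional using (_∈_; _∉_)
open import Data.List.Membership.Propositional.Properties using (∈-++⁺ˡ; ∈-++⁺ʳ; ∈-++⁻; ∈-∃++; ∈-filter⁻)
open import Data.List.Relation.Binary.Subset.Propositional using (_⊆_)
open import Data.List.Relation.Unary.All as All using (All; []; _∷_)
import Data.List.Relation.Unary.All.Properties as All
open import Data.List.Relation.Unary.Any as Any using (Any; here; there)
open import Data.List.Relation.Unary.Any.Properties using (reverse⁺; reverse⁻)
open import Data.List.Relation.Unary.Linked as Linked using (Linked; []; [-]; _∷_)
open import Data.List.Relation.Unary.Unique.Propositional using (Unique; []; _∷_)
import Data.List.Relation.Unary.Unique.Propositional.Properties as Unique
import Data.List.Relation.Binary.Permutation.Setoid as Permutation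
import Data.List.Relation.Binary.Permutation.Setoid.Properties as PermutationProperties
open import Data.Product using (∃-syntax; _×_; _,_; proj₁; proj₂)
open import Data.Sum using (inj₁; inj₂; [_,_]′)
open import Relation.Nullary using (yes; no; contradiction)
open import Relation.Unary using (Pred; Decidable; ∁)
open import Relation.Binary.PropositionalEquality using (_≢_; refl; trans; cong; cong₂; subst; setoid)
import Relation.Binary.PropositionalEquality as ≡

module _ {a} {A : Set a} where

  ∈-++-∷ʳ : ∀ xs {y ys} {w : A} → w ∈ xs ++ [ y ] → w ∈ xs ++ y ∷ ys
  ∈-++-∷ʳ xs {y} {ys} w∈ = subst (_ ∈_) (∷ʳ-++ xs y ys) (∈-++⁺ˡ w∈)

  ∈-++-∷⁻ : ∀ xs {y ys} {w : A} → w ∈ xs ++ y ∷ ys → w ≢ y → w ∈ xs ++ ys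
  ∈-++-∷⁻ xs w∈ w≢y with ∈-++⁻ xs w∈
  ... | inj₁ w∈xs         = ∈-++⁺ˡ w∈xs
  ... | inj₂ (here w≡y)   = contradiction w≡y w≢y
  ... | inj₂ (there w∈ys) = ∈-++⁺ʳ xs w∈ys

  last-++-∷ : ∀ xs {y : A} {ys} → last (xs ++ y ∷ ys) ≡ last (y ∷ ys)
  last-++-∷ []           = refl
  last-++-∷ (x ∷ [])     = refl
  last-++-∷ (x ∷ x′ ∷ xs) = last-++-∷ (x′ ∷ xs)

  last⇒∈ : ∀ xs {w : A} → last xs ≡ just w → w ∈ xs
  last⇒∈ (x ∷ [])      refl = here refl
  last⇒∈ (x ∷ x′ ∷ xs) eq   = there (last⇒∈ (x′ ∷ xs) eq)

  1≤length-++-∷ : ∀ xs {y : A} {ys} → 1 ≤ length (xs ++ y ∷ ys)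
  1≤length-++-∷ xs {y} {ys} = subst (1 ≤_) (≡.sym (length-++-sucʳ xs y ys)) (s≤s z≤n)

  All-reverse : ∀ {p} {P : Pred A p} {xs} → All P xs → All P (reverse xs)
  All-reverse Pxs = All.tabulate (All.lookup Pxs ∘ reverse⁻)

  first-split : ∀ {p} {P : Pred A p} → Decidable P → ∀ {xs} → Any P xs →
                ∃[ ys ] ∃[ y ] ∃[ zs ] xs ≡ ys ++ y ∷ zs × All (∁ P) ys × P y
  first-split P? {x ∷ xs} Pxs with P? x | Pxs
  ... | yes Px | _        = [] , x , xs , refl , [] , Px
  ... | no ¬Px | here Px  = contradiction Px ¬Px
  ... | no ¬Px | there Pxs′ with first-split P? Pxs′
  ...   | ys , y , zs , refl , ¬Pys , Py = x ∷ ys , y , zs , refl , ¬Px ∷ ¬Pys , Py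

  Unique-++⁻ˡ : ∀ xs {ys : List A} → Unique (xs ++ ys) → Unique xs
  Unique-++⁻ˡ []       _          = []
  Unique-++⁻ˡ (x ∷ xs) (x∉ ∷ !xs) = All.++⁻ˡ xs x∉ ∷ Unique-++⁻ˡ xs !xs

  Unique-++⁻ʳ : ∀ xs {ys : List A} → Unique (xs ++ ys) → Unique ys
  Unique-++⁻ʳ []       !ys       = !ys
  Unique-++⁻ʳ (x ∷ xs) (_ ∷ !xs) = Unique-++⁻ʳ xs !xs

  Unique-reverse : ∀ {xs : List A} → Unique xs → Unique (reverse xs)
  Unique-reverse {xs} = PermutationProperties.Unique-resp-↭ (setoid A)
    (Permutation.↭-sym (setoid A) (PermutationProperties.↭-reverse (setoid A) xs))

  Unique-⊆⇒length≤ : ∀ {xs ys : List A} → Unique xs → xs ⊆ ys → length xs ≤ length ys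
  Unique-⊆⇒length≤ [] _ = z≤n
  Unique-⊆⇒length≤ {x ∷ xs} {ys} (x≢xs ∷ !xs) xs⊆ys with ∈-∃++ (xs⊆ys (here refl))
  ... | ys₁ , ys₂ , refl = begin
    suc (length xs)           ≤⟨ s≤s (Unique-⊆⇒length≤ !xs xs⊆ys₁++ys₂) ⟩
    suc (length (ys₁ ++ ys₂)) ≡⟨ length-++-sucʳ ys₁ x ys₂ ⟨
    length (ys₁ ++ x ∷ ys₂)   ∎
    where
    open ≤-Reasoning
    xs⊆ys₁++ys₂ : xs ⊆ ys₁ ++ ys₂
    xs⊆ys₁++ys₂ w∈xs = ∈-++-∷⁻ ys₁ (xs⊆ys (there w∈xs)) (All.lookup x≢xs w∈xs ∘ ≡.sym)

  module _ {r} {R : A → A → Set r} where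

    Linked-++⁻ˡ : ∀ xs {ys} → Linked R (xs ++ ys) → Linked R xs
    Linked-++⁻ˡ []            _          = []
    Linked-++⁻ˡ (x ∷ [])      _          = [-]
    Linked-++⁻ˡ (x ∷ x′ ∷ xs) (Rxx′ ∷ l) = Rxx′ ∷ Linked-++⁻ˡ (x′ ∷ xs) l

    Linked-++⁻ʳ : ∀ xs {ys} → Linked R (xs ++ ys) → Linked R ys
    Linked-++⁻ʳ []       l = l
    Linked-++⁻ʳ (x ∷ xs) l = Linked-++⁻ʳ xs (Linked.tail l)

    Linked-join : ∀ xs {y ys} → Linked R (xs ++ [ y ]) → Linked R (y ∷ ys) → Linked R (xs ++ y ∷ ys)
    Linked-join []            _           l = l
    Linked-join (x ∷ [])      (Rxy ∷ _)   l = Rxy ∷ l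
    Linked-join (x ∷ x′ ∷ xs) (Rxx′ ∷ l′) l = Rxx′ ∷ Linked-join (x′ ∷ xs) l′ l

    Linked-last : ∀ xs {u y} → Linked R (xs ++ [ y ]) → last xs ≡ just u → R u y
    Linked-last (x ∷ [])      (Rxy ∷ _) refl = Rxy
    Linked-last (x ∷ x′ ∷ xs) (_ ∷ l)   eq   = Linked-last (x′ ∷ xs) l eq

    Linked-reverse : ∀ {xs} → Linked R xs → Linked (flip R) (reverse xs)
    Linked-reverse []        = []
    Linked-reverse [-]       = [-]
    Linked-reverse (Rxy ∷ l) = onto (Rxy ∷ [-]) l
      where
      onto : ∀ {x xs acc} → Linked (flip R) (x ∷ acc) → Linked R (x ∷ xs) →
             Linked (flip R) (reverseAcc (x ∷ acc) xs)
      onto l′ [-]       = l′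
      onto l′ (Rxy ∷ l) = onto (Rxy ∷ l′) l

split-at-lookup : ∀ {a} {A : Set a} (xs : List A) (i : Fin (length xs)) →
                  ∃[ ys ] ∃[ zs ] xs ≡ ys ++ lookup xs i ∷ zs × length ys ≡ toℕ i
split-at-lookup (x ∷ xs) Fin.zero    = [] , xs , refl , refl
split-at-lookup (x ∷ xs) (Fin.suc i) with split-at-lookup xs i
... | ys , zs , eq , len = x ∷ ys , zs , cong (x ∷_) eq , cong suc len

c+c*c≤2*c^2 : ∀ c .{{_ : NonZero c}} → c + c * c ≤ 2 * c ^ 2
c+c*c≤2*c^2 c = begin
  c + c * c     ≤⟨ +-monoˡ-≤ (c * c) (m≤m*n c c) ⟩
  c * c + c * c ≡⟨ cong₂ _+_ c*c≡c^2 (trans c*c≡c^2 (≡.sym (+-identityʳ (c ^ 2)))) ⟩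
  2 * c ^ 2     ∎
  where
  open ≤-Reasoning
  c*c≡c^2 : c * c ≡ c ^ 2
  c*c≡c^2 = cong (c *_) (≡.sym (*-identityʳ c))

module Paths {n : ℕ} (G : Graph n) where

  path-prefix : ∀ xs {y ys} → IsPath G (xs ++ y ∷ ys) → IsPath G (xs ++ [ y ])
  path-prefix xs {y} {ys} p = record
    { nonempty = 1≤length-++-∷ xs
    ; distinct = Unique-++⁻ˡ (xs ++ [ y ]) (subst Unique (≡.sym (∷ʳ-++ xs y ys)) (IsPath.distinct p))
    ; linked   = Linked-++⁻ˡ (xs ++ [ y ]) (subst (Linked _) (≡.sym (∷ʳ-++ xs y ys)) (IsPath.linked p))
    }

  path-suffix : ∀ xs {y ys} → IsPath G (xs ++ y ∷ ys) → IsPath G (y ∷ ys)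
  path-suffix xs p = record
    { nonempty = s≤s z≤n
    ; distinct = Unique-++⁻ʳ xs (IsPath.distinct p)
    ; linked   = Linked-++⁻ʳ xs (IsPath.linked p)
    }

  path-join : ∀ xs {y ys} → IsPath G (xs ++ [ y ]) → IsPath G (y ∷ ys) → All (_∉ y ∷ ys) xs →
              IsPath G (xs ++ y ∷ ys)
  path-join xs p q xs∉ = record
    { nonempty = 1≤length-++-∷ xs
    ; distinct = Unique.++⁺ (Unique-++⁻ˡ xs (IsPath.distinct p)) (IsPath.distinct q)
                            (λ (w∈xs , w∈ys) → All.lookup xs∉ w∈xs w∈ys)
    ; linked   = Linked-join xs (IsPath.linked p) (IsPath.linked q)
    }

  path-reverse : ∀ {xs} → IsPath G xs → IsPath G (reverse xs)
  path-reverse {xs} p = record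
    { nonempty = subst (1 ≤_) (≡.sym (length-reverse xs)) (IsPath.nonempty p)
    ; distinct = Unique-reverse (IsPath.distinct p)
    ; linked   = Linked.map (Graph.sym G) (Linked-reverse (IsPath.linked p))
    }

  path-reverse-ends : ∀ {a xs b} → IsPath G (a ∷ xs ++ [ b ]) → IsPath G (b ∷ reverse xs ++ [ a ])
  path-reverse-ends {a} {xs} {b} p =
    subst (IsPath G) (trans (unfold-reverse a (xs ++ [ b ])) (cong (_++ [ a ]) (reverse-++ xs [ b ])))
          (path-reverse p)

  path-ends-at : ∀ xs {y ys} → IsPath G (xs ++ y ∷ ys) → last (xs ++ y ∷ ys) ≡ just y → ys ≡ []
  path-ends-at xs {ys = []}     _ _   = refl
  path-ends-at xs {ys = z ∷ zs} p end =
    contradiction (last⇒∈ (z ∷ zs) (trans (≡.sym (last-++-∷ xs)) end))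
                  (Unique.Unique[x∷xs]⇒x∉xs (IsPath.distinct (path-suffix xs p)))

  cycle⇒path : ∀ {C} → IsCycle G C → IsPath G C
  cycle⇒path cyc = record
    { nonempty = ≤-trans (s≤s z≤n) (IsCycle.atLeast3 cyc)
    ; distinct = IsCycle.distinct cyc
    ; linked   = IsCycle.linked cyc
    }

  length-arcs : ∀ {a : Fin n} U {b} W → length (a ∷ U ++ b ∷ W) ≡ suc (suc (length U + length W))
  length-arcs U {b} W = cong suc (trans (length-++-sucʳ U b W) (cong suc (length-++ U)))

  arcs⇒cycle : ∀ {a U b W} → IsPath G (a ∷ U ++ [ b ]) → IsPath G (b ∷ W ++ [ a ]) →
               All (_∉ a ∷ U ++ [ b ]) W → 1 ≤ length U + length W → IsCycle G (a ∷ U ++ b ∷ W)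
  arcs⇒cycle {a} {U} {b} {W} arc ret W∉arc nontrivial = record
    { atLeast3 = subst (3 ≤_) (≡.sym (length-arcs {a} U {b} W)) (s≤s (s≤s nontrivial))
    ; distinct = subst Unique (cong (a ∷_) (∷ʳ-++ U b W))
                   (Unique.++⁺ (IsPath.distinct arc) !W (λ (w∈arc , w∈W) → All.lookup W∉arc w∈W w∈arc))
    ; linked   = Linked-join (a ∷ U) (IsPath.linked arc) (Linked-++⁻ˡ (b ∷ W) (IsPath.linked ret))
    ; closes   = λ { refl end → Linked-last (b ∷ W) (IsPath.linked ret) (trans (≡.sym (last-++-∷ (a ∷ U))) end) }
    }
    where
    !W : Unique W
    !W = Unique-++⁻ˡ W (Unique-++⁻ʳ [ b ] (IsPath.distinct ret))

  longest-prefix≤ : ∀ S {y T A B} → IsLongestPath G (S ++ y ∷ T) → IsPath G (A ++ y ∷ B) →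
                    All (_∉ y ∷ T) A → length A ≤ length S
  longest-prefix≤ S {y} {T} {A} (pP , maximal) pQ A∉ = +-cancelʳ-≤ (suc (length T)) (length A) (length S) (begin
    length A + suc (length T) ≡⟨ length-++ A ⟨
    length (A ++ y ∷ T)       ≤⟨ maximal _ (path-join A (path-prefix A pQ) (path-suffix S pP) A∉) ⟩
    length (S ++ y ∷ T)       ≡⟨ length-++ S ⟩
    length S + suc (length T) ∎)
    where open ≤-Reasoning

  start-meets-prefix : ∀ (Pt : List (Fin n)) {v Pr A y B x₁} → Unique (Pt ++ v ∷ Pr) →
                       head (Pt ++ v ∷ Pr) ≡ just x₁ → head (A ++ y ∷ B) ≡ just x₁ →
                       All (_∉ v ∷ Pr) A → y ∈ Pr → Any (_∈ Pt) A
  start-meets-prefix []       {A = []}    !P refl refl _  y∈Pr = contradiction y∈Pr (Unique.Unique[x∷xs]⇒x∉xs !P)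
  start-meets-prefix []       {A = _ ∷ _} _  refl refl A∉ _    = contradiction (here refl) (All.head A∉)
  start-meets-prefix (_ ∷ Pt) {A = []}    !P refl refl _  y∈Pr =
    contradiction (∈-++⁺ʳ Pt (there y∈Pr)) (Unique.Unique[x∷xs]⇒x∉xs !P)
  start-meets-prefix (_ ∷ _)  {A = _ ∷ _} _  refl refl _  _    = here (here refl)

module BoundedCircumference {n : ℕ} (G : Graph n) (c : ℕ) (circ : CircumferenceLessThan G (2 + c)) where

  open Paths G
  open import Data.List.Membership.DecPropositional (Fin._≟_ {n}) using (_∈?_)

  cycle-length≤ : ∀ {C} → IsCycle G C → length C ≤ suc c
  cycle-length≤ cyc = ≤-pred (circ _ cyc)

  arcs-length< : ∀ {a U b W} → IsPath G (a ∷ U ++ [ b ]) → IsPath G (b ∷ W ++ [ a ]) →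
                 All (_∉ a ∷ U ++ [ b ]) W → 1 ≤ length U + length W → length U + length W < c
  arcs-length< {a} {U} {b} {W} arc ret W∉arc nontrivial =
    ≤-pred (subst (_≤ suc c) (length-arcs {a} U {b} W) (cycle-length≤ (arcs⇒cycle arc ret W∉arc nontrivial)))

  ear-on-arc-length< : ∀ C₀ {r C₂ x C₃ W} → IsCycle G (C₀ ++ r ∷ C₂ ++ x ∷ C₃) →
                       IsPath G (x ∷ W ++ [ r ]) → All (_∉ C₀ ++ r ∷ C₂ ++ x ∷ C₃) W → 1 ≤ length W →
                       length W < c
  ear-on-arc-length< C₀ {r} {C₂} {x} {W = W} cyc ear W∉C nontrivial =
    ≤-<-trans (m≤n+m _ (length C₂)) (arcs-length< arc ear W∉arc (≤-trans nontrivial (m≤n+m _ _)))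
    where
    arc : IsPath G (r ∷ C₂ ++ [ x ])
    arc = path-prefix (r ∷ C₂) (path-suffix C₀ (cycle⇒path cyc))
    W∉arc : All (_∉ r ∷ C₂ ++ [ x ]) W
    W∉arc = All.map (λ w∉C → w∉C ∘ ∈-++⁺ʳ C₀ ∘ ∈-++-∷ʳ (r ∷ C₂)) W∉C

  ear-length< : ∀ {C r x N} → IsCycle G C → r ∈ C → x ∈ C → IsPath G (r ∷ N ++ [ x ]) → All (_∉ C) N →
                length N < c
  ear-length< {N = []} cyc _ _ _ _ = <⇒≤ (≤-pred (≤-trans (IsCycle.atLeast3 cyc) (cycle-length≤ cyc)))
  ear-length< {C} {r} {x} {N@(_ ∷ _)} cyc r∈C x∈C ear N∉C with ∈-∃++ r∈C
  ... | C₀ , C₁ , refl with ∈-++⁻ C₀ x∈C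
  ... | inj₂ (here refl) = contradiction (∈-++⁺ʳ N (here refl)) (Unique.Unique[x∷xs]⇒x∉xs (IsPath.distinct ear))
  ... | inj₂ (there x∈C₁) with ∈-∃++ x∈C₁
  ...   | C₂ , C₃ , refl =
    subst (_< c) (length-reverse N)
      (ear-on-arc-length< C₀ cyc (path-reverse-ends {xs = N} ear) (All-reverse N∉C)
                          (subst (1 ≤_) (≡.sym (length-reverse N)) (s≤s z≤n)))
  ear-length< {C} {r} {x} {N@(_ ∷ _)} cyc r∈C x∈C ear N∉C | C₀ , C₁ , refl | inj₁ x∈C₀ with ∈-∃++ x∈C₀
  ... | C₂ , C₃ , refl =
    ear-on-arc-length< C₂ (subst (IsCycle G) reassoc cyc) ear (subst (λ C → All (_∉ C) N) reassoc N∉C) (s≤s z≤n)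
    where
    reassoc : (C₂ ++ x ∷ C₃) ++ r ∷ C₁ ≡ C₂ ++ x ∷ C₃ ++ r ∷ C₁
    reassoc = ++-assoc C₂ (x ∷ C₃) (r ∷ C₁)

  hits-length≤ : ∀ {C r xs} → IsCycle G C → r ∈ C → Unique (r ∷ xs) → length (filter (_∈? C) xs) ≤ c
  hits-length≤ {C} {r} {xs} cyc r∈C !rxs = ≤-pred (begin
    suc (length (filter (_∈? C) xs))  ≡⟨ cong length (filter-accept (_∈? C) r∈C) ⟨
    length (filter (_∈? C) (r ∷ xs))  ≤⟨ Unique-⊆⇒length≤ (Unique.filter⁺ (_∈? C) !rxs)
                                                             (proj₂ ∘ ∈-filter⁻ (_∈? C)) ⟩
    length C                          ≤⟨ cycle-length≤ cyc ⟩
    suc c                             ∎)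
    where open ≤-Reasoning

  -- N is the part of the path already walked since it last left C.
  ears-length≤ : ∀ {C r s} → IsCycle G C → r ∈ C → s ∈ C → ∀ N xs → All (_∉ C) N →
                 IsPath G (r ∷ N ++ xs) → last (r ∷ N ++ xs) ≡ just s →
                 length N + length xs ≤ c * length (filter (_∈? C) xs)
  ears-length≤ cyc r∈C s∈C []      [] _   _ _   = z≤n
  ears-length≤ {s = s} cyc r∈C s∈C (m ∷ N) [] N∉C _ end =
    contradiction s∈C (All.lookup N∉C (subst (s ∈_) (++-identityʳ (m ∷ N)) (last⇒∈ (m ∷ N ++ []) end)))
  ears-length≤ {C} {r} cyc r∈C s∈C N (x ∷ xs) N∉C p end with x ∈? C
  ... | yes x∈C = begin
    length N + suc (length xs)            ≡⟨ +-suc (length N) (length xs) ⟩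
    suc (length N) + length xs            ≤⟨ +-mono-≤ (ear-length< cyc r∈C x∈C (path-prefix (r ∷ N) p) N∉C)
                                                      (ears-length≤ cyc x∈C s∈C [] xs [] (path-suffix (r ∷ N) p)
                                                                    (trans (≡.sym (last-++-∷ (r ∷ N))) end)) ⟩
    c + c * length (filter (_∈? C) xs)    ≡⟨ *-suc c _ ⟨
    c * suc (length (filter (_∈? C) xs))  ∎
    where open ≤-Reasoning
  ... | no x∉C = begin
    length N + suc (length xs)            ≡⟨ +-assoc (length N) 1 (length xs) ⟨
    length N + 1 + length xs              ≡⟨ cong (_+ length xs) (length-++ N) ⟨
    length (N ++ [ x ]) + length xs       ≤⟨ ears-length≤ cyc r∈C s∈C (N ++ [ x ]) xs (All.++⁺ N∉C (x∉C ∷ []))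
                                                           (subst (IsPath G) reassoc p)
                                                           (trans (cong last (≡.sym reassoc)) end) ⟩
    c * length (filter (_∈? C) xs)        ∎
    where
    open ≤-Reasoning
    reassoc : r ∷ N ++ x ∷ xs ≡ r ∷ (N ++ [ x ]) ++ xs
    reassoc = cong (r ∷_) (≡.sym (∷ʳ-++ N x xs))

  path-between-cycle-length≤ : ∀ {C r s xs} → IsCycle G C → r ∈ C → s ∈ C → IsPath G (r ∷ xs) →
                               last (r ∷ xs) ≡ just s → length xs ≤ c * c
  path-between-cycle-length≤ {C} {xs = xs} cyc r∈C s∈C p end = begin
    length xs                       ≤⟨ ears-length≤ cyc r∈C s∈C [] xs [] p end ⟩
    c * length (filter (_∈? C) xs)  ≤⟨ *-monoʳ-≤ c (hits-length≤ cyc r∈C (IsPath.distinct p)) ⟩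
    c * c                           ∎
    where open ≤-Reasoning

  cycle-through-segment : ∀ Pt {v D y T R} → IsPath G (Pt ++ v ∷ D ++ y ∷ T) → IsPath G (y ∷ R) →
                          All (_∉ v ∷ D ++ y ∷ T) R → Any (_∈ Pt) R →
                          ∃[ C ] IsCycle G C × v ∈ C × y ∈ C × suc (length D) < c
  cycle-through-segment Pt {v} {D} {y} {T} pP pR R∉S R∩Pt with first-split (_∈? Pt) R∩Pt
  ... | R₁ , z , R₂ , refl , R₁∉Pt , z∈Pt with ∈-∃++ z∈Pt
  ... | T₁ , T₂ , refl =
    z ∷ U ++ y ∷ R₁ , arcs⇒cycle arc ret R₁∉arc (≤-trans (s≤s z≤n) D<U+R₁) ,
    there (∈-++⁺ˡ (∈-++⁺ʳ T₂ (here refl))) , there (∈-++⁺ʳ U (here refl)) ,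
    ≤-<-trans D<U+R₁ (arcs-length< arc ret R₁∉arc (≤-trans (s≤s z≤n) D<U+R₁))
    where
    U : List (Fin n)
    U = T₂ ++ v ∷ D
    reassoc : (T₁ ++ z ∷ T₂) ++ v ∷ D ++ y ∷ T ≡ T₁ ++ z ∷ U ++ y ∷ T
    reassoc = trans (++-assoc T₁ (z ∷ T₂) _)
                    (cong (λ t → T₁ ++ z ∷ t) (≡.sym (++-assoc T₂ (v ∷ D) (y ∷ T))))
    arc : IsPath G (z ∷ U ++ [ y ])
    arc = path-prefix (z ∷ U) (path-suffix T₁ (subst (IsPath G) reassoc pP))
    ret : IsPath G (y ∷ R₁ ++ [ z ])
    ret = path-prefix (y ∷ R₁) pR
    arc⊆P : z ∷ U ++ [ y ] ⊆ (T₁ ++ z ∷ T₂) ++ v ∷ D ++ y ∷ T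
    arc⊆P w∈arc = subst (_ ∈_) (≡.sym reassoc) (∈-++⁺ʳ T₁ (∈-++-∷ʳ (z ∷ U) w∈arc))
    R₁∉arc : All (_∉ z ∷ U ++ [ y ]) R₁
    R₁∉arc = All.zipWith (λ (w∉Pt , w∉S) → [ w∉Pt , w∉S ]′ ∘ ∈-++⁻ (T₁ ++ z ∷ T₂) ∘ arc⊆P)
                         (R₁∉Pt , All.++⁻ˡ R₁ R∉S)
    D<U+R₁ : length D < length U + length R₁
    D<U+R₁ = ≤-trans (length-++-≤ʳ (v ∷ D) {T₂}) (m≤m+n _ _)

  detour-through-tail : ∀ Pt {v D y T A B x₁} → IsLongestPath G (Pt ++ v ∷ D ++ y ∷ T) →
                        head (Pt ++ v ∷ D ++ y ∷ T) ≡ just x₁ → IsPath G (A ++ y ∷ B) →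
                        head (A ++ y ∷ B) ≡ just x₁ → last (A ++ y ∷ B) ≡ just v →
                        All (_∉ v ∷ D ++ y ∷ T) A → length (A ++ y ∷ B) ≤ suc (length Pt + (c + c * c))
  detour-through-tail Pt {v} {D} {y} {T} {A} {B} longest startP pQ startQ endQ A∉
    with cycle-through-segment Pt (proj₁ longest) yA (All-reverse A∉) (reverse⁺ A∩Pt)
    where
    yA : IsPath G (y ∷ reverse A)
    yA = subst (IsPath G) (reverse-++ A [ y ]) (path-reverse (path-prefix A pQ))
    A∩Pt : Any (_∈ Pt) A
    A∩Pt = start-meets-prefix Pt (IsPath.distinct (proj₁ longest)) startP startQ A∉ (∈-++⁺ʳ D (here refl))
  ... | C , cyc , v∈C , y∈C , D<c = begin
    length (A ++ y ∷ B)                       ≡⟨ length-++ A ⟩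
    length A + suc (length B)                 ≤⟨ +-mono-≤ A≤ (s≤s B≤) ⟩
    length (Pt ++ v ∷ D) + suc (c * c)        ≡⟨ cong (_+ suc (c * c)) (length-++ Pt) ⟩
    length Pt + suc (length D) + suc (c * c)  ≤⟨ +-monoˡ-≤ (suc (c * c)) (+-monoʳ-≤ (length Pt) (<⇒≤ D<c)) ⟩
    length Pt + c + suc (c * c)               ≡⟨ +-assoc (length Pt) c _ ⟩
    length Pt + (c + suc (c * c))             ≡⟨ cong (length Pt +_) (+-suc c _) ⟩
    length Pt + suc (c + c * c)               ≡⟨ +-suc (length Pt) _ ⟩
    suc (length Pt + (c + c * c))             ∎
    where
    open ≤-Reasoning
    A≤ : length A ≤ length (Pt ++ v ∷ D)
    A≤ = longest-prefix≤ (Pt ++ v ∷ D) (subst (IsLongestPath G) (≡.sym (++-assoc Pt (v ∷ D) (y ∷ T))) longest)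
                         pQ (All.map (_∘ ∈-++⁺ʳ (v ∷ D)) A∉)
    B≤ : length B ≤ c * c
    B≤ = path-between-cycle-length≤ cyc y∈C v∈C (path-suffix A pQ) (trans (≡.sym (last-++-∷ A)) endQ)

  longest-path-detour : ∀ Pt {v Pr x₁ Q} → IsLongestPath G (Pt ++ v ∷ Pr) → head (Pt ++ v ∷ Pr) ≡ just x₁ →
                        IsPathBetween G x₁ v Q → length Q ≤ suc (length Pt + (c + c * c))
  longest-path-detour Pt {v} {Pr} {Q = Q} longest startP (pQ , startQ , endQ)
    with first-split (_∈? v ∷ Pr) (Any.map (λ v≡w → here (≡.sym v≡w)) (last⇒∈ Q endQ))
  ... | A , y , B , refl , A∉ , there y∈Pr with ∈-∃++ y∈Pr
  ...   | D , T , refl = detour-through-tail Pt longest startP pQ startQ endQ A∉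
  longest-path-detour Pt {v} {Pr} longest startP (pQ , startQ , endQ)
    | A , y , B , refl , A∉ , here refl with path-ends-at A pQ endQ
  ...   | refl = begin
    length (A ++ [ v ])            ≡⟨ trans (length-++ A) (+-comm (length A) 1) ⟩
    suc (length A)                 ≤⟨ s≤s (≤-trans (longest-prefix≤ Pt longest pQ A∉) (m≤m+n _ _)) ⟩
    suc (length Pt + (c + c * c))  ∎
    where open ≤-Reasoning

lemma3p14 : (k : ℕ) → 3 ≤ k → {n : ℕ} → (G : Graph n) → CircumferenceLessThan G k →
    (P : List (Fin n)) → IsLongestPath G P →
    (x₁ : Fin n) → head P ≡ just x₁ →
    (i : Fin (length P)) → (Q : List (Fin n)) →
    IsPathBetween G x₁ (lookup P i) Q →
    length Q ∸ 1 ≤ suc (toℕ i) ∸ 1 + 2 * (k ∸ 2) ^ 2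
lemma3p14 (suc (suc c)) (s≤s (s≤s (s≤s _))) G circ P longest x₁ startP i Q between
  with split-at-lookup P i
... | Pt , Pr , P≡ , |Pt|≡i = begin
  length Q ∸ 1             ≤⟨ ∸-monoˡ-≤ 1 (longest-path-detour Pt (subst (IsLongestPath G) P≡ longest)
                                                          (subst (λ P → head P ≡ just x₁) P≡ startP) between) ⟩
  length Pt + (c + c * c)  ≡⟨ cong (_+ (c + c * c)) |Pt|≡i ⟩
  toℕ i + (c + c * c)      ≤⟨ +-monoʳ-≤ (toℕ i) (c+c*c≤2*c^2 c) ⟩
  toℕ i + 2 * c ^ 2        ∎
  where
  open ≤-Reasoning
  open BoundedCircumference G c circ
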